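{- Say a word $\sigma=\sigma_1\cdots\sigma_n$ over $\{1,\dots,k\}$ avoids $122$ if there is no index $i$ with $\sigma_i<\sigma_{i+1}=\sigma_{i+2}$, and let $F_{122}(x;k)=\sum_{n\ge0}f_{122}(n,k)x^n$, where $f_{122}(n,k)$ is the number of such words of length $n$. Then for all $k\ge0$, \[ F_{122}(x;k)=\frac{x}{(1-x^2)^k-(1-x)}. \]
   Context: The empty word (length $0$) is counted once; for $k=0$ there are no words of positive length. -}

module Defs where

open import Data.Nat using (ℕ; zero; suc; _∸_; _<ᵇ_; _≡ᵇ_)
open import Data.Integer using (ℤ; +_; _*_; _+_; _-_)
open import Data.Fin using (Fin; toℕ)
open import Data.Bool using (Bool; true; false; _∧_; not; if_then_else_)
open import Data.List using (List; []; _∷_; length; map; concatMap; allFin; filter; upTo; foldr)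
open import Relation.Binary.PropositionalEquality using (_≡_)
open import Data.Bool.Properties using (_≟_)

-- Words over {1,...,k} are lists over Fin k (letter a ↔ toℕ a + 1; order preserved).
-- All words of length n over Fin k.
words : (k n : ℕ) → List (List (Fin k))
words k zero    = [] ∷ []
words k (suc n) = concatMap (λ a → map (a ∷_) (words k n)) (allFin k)

avoids122 : {k : ℕ} → List (Fin k) → Bool
avoids122 (a ∷ b ∷ c ∷ rest) =
  not ((toℕ a <ᵇ toℕ b) ∧ (toℕ b ≡ᵇ toℕ c)) ∧ avoids122 (b ∷ c ∷ rest)
avoids122 _ = true

f122 : ℕ → ℕ → ℕ
f122 n k = length (filter (λ w → avoids122 w ≟ true) (words k n))

PS : Set
PS = ℕ → ℤ

_⊕_ : PS → PS → PS
(f ⊕ g) n = f n + g n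

_⊖_ : PS → PS → PS
(f ⊖ g) n = f n - g n

_⊛_ : PS → PS → PS
(f ⊛ g) n = foldr _+_ (+ 0) (map (λ i → f i * g (n ∸ i)) (upTo (suc n)))

𝟙 : PS
𝟙 zero = + 1
𝟙 (suc _) = + 0

𝕩 : PS
𝕩 (suc zero) = + 1
𝕩 _ = + 0

_^ˢ_ : PS → ℕ → PS
f ^ˢ zero = 𝟙
f ^ˢ suc m = f ⊛ (f ^ˢ m)

F122 : ℕ → PS
F122 k n = + f122 n k

den : ℕ → PS
den k = ((𝟙 ⊖ (𝕩 ⊛ 𝕩)) ^ˢ k) ⊖ (𝟙 ⊖ 𝕩)

-- Let G_a be the series whose n-th coefficient counts the 122-avoiders a σ with |σ| = n.
-- A word a b c σ avoids 122 iff b c σ does and not a < b = c, and the words b b σ are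
-- counted by G_b; hence G_a = F − x² Σ_{b > a} G_b, and by downward induction on a,
-- G_a = F (1 − x²)^(k−1−a).  Since F = 1 + x Σ_a G_a and x² Σ_{j<k} (1 − x²)^j = 1 − (1 − x²)^k,
-- this gives F ((1 − x²)^k − (1 − x)) = x.
module Submission where

open import Defs
open import Data.Integer.Properties using (+-0-commutativeMonoid; +-identityˡ; +-identityʳ; +-comm; +-assoc; *-comm; *-identityˡ; pos-+)
open import Algebra.Properties.CommutativeMonoid.Sum +-0-commutativeMonoid
  using (sum-syntax; sum-cong-≗; ∑-distrib-+; sum-replicate-zero; sum-init-last; ∑-permute)
open import Data.Bool using (Bool; true; false; _∧_; not; if_then_else_)
open import Data.Bool.Properties using (_≟_)
open import Data.Fin using (Fin; zero; suc; toℕ; opposite)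
open import Data.Fin.Permutation as Permutation using ()
open import Data.Fin.Properties using (toℕ≤pred[n]; opposite-prop; toℕ-inject₁; toℕ-fromℕ)
open import Data.Integer using (ℤ; +_; _+_; _-_; _*_)
open import Data.Integer.Tactic.RingSolver using (solve-∀)
open import Data.List using (List; []; _∷_; _++_; length; filter; map; concatMap; applyUpTo; tabulate; foldr)
open import Data.List.Properties using (length-++; filter-++)
open import Data.Nat as ℕ using (ℕ; zero; suc; _∸_; _<ᵇ_; _≡ᵇ_)
open import Data.Nat.Properties using (m∸[m∸n]≡n)
open import Function using (_∘_; id)
open import Relation.Binary.PropositionalEquality using (_≡_; _≗_; refl; sym; trans; cong; cong₂; module ≡-Reasoning)

open ≡-Reasoning

∑-distrib-- : ∀ {n} (f g : Fin n → ℤ) → ∑[ i < n ] (f i - g i) ≡ ∑[ i < n ] f i - ∑[ i < n ] g i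
∑-distrib-- {zero}  f g = refl
∑-distrib-- {suc n} f g = trans (cong (_+_ (f zero - g zero)) (∑-distrib-- (f ∘ suc) (g ∘ suc)))
                                (interchange (f zero) (g zero) _ _)
  where
  interchange : ∀ a b c d → (a - b) + (c - d) ≡ (a + c) - (b + d)
  interchange = solve-∀

∑-reverse : ∀ n (h : ℕ → ℤ) → ∑[ i < n ] h (n ∸ suc (toℕ i)) ≡ ∑[ i < n ] h (toℕ i)
∑-reverse n h = begin
  ∑[ i < n ] h (n ∸ suc (toℕ i))     ≡⟨ sum-cong-≗ {n} (λ i → cong h (sym (opposite-prop i))) ⟩
  ∑[ i < n ] h (toℕ (opposite i))    ≡⟨ ∑-permute {n} (h ∘ toℕ) Permutation.reverse ⟨
  ∑[ i < n ] h (toℕ i)               ∎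

∑-toℕ-suc : ∀ n (h : ℕ → ℤ) → ∑[ i < suc n ] h (toℕ i) ≡ ∑[ i < n ] h (toℕ i) + h n
∑-toℕ-suc n h = trans (sum-init-last {n} (h ∘ toℕ))
  (cong₂ _+_ (sum-cong-≗ {n} (cong h ∘ toℕ-inject₁)) (cong h (toℕ-fromℕ n)))

∑-pull-out : ∀ {k} (h : Fin k → ℤ) (b : Fin k) →
             ∑[ c < k ] (if not (toℕ b ≡ᵇ toℕ c) then h c else + 0) + h b ≡ ∑[ c < k ] h c
∑-pull-out {suc k} h zero    =
  trans (cong (_+ h zero) (+-identityˡ (∑[ c < k ] h (suc c)))) (+-comm (∑[ c < k ] h (suc c)) (h zero))
∑-pull-out {suc k} h (suc b) = trans (+-assoc (h zero) _ (h (suc b))) (cong (_+_ (h zero)) (∑-pull-out (h ∘ suc) b))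

∑-above : ∀ {k} (a : Fin k) (h : ℕ → ℤ) →
          ∑[ b < k ] (if toℕ a <ᵇ toℕ b then h (k ∸ suc (toℕ b)) else + 0) ≡ ∑[ i < k ∸ suc (toℕ a) ] h (toℕ i)
∑-above {suc k} zero    h = trans (+-identityˡ _) (∑-reverse k h)
∑-above {suc k} (suc a) h = trans (+-identityˡ _) (∑-above a h)

foldr-applyUpTo : ∀ m (h : ℕ → ℤ) (φ : ℕ → ℕ) →
                  foldr _+_ (+ 0) (map h (applyUpTo φ m)) ≡ ∑[ i < m ] h (φ (toℕ i))
foldr-applyUpTo zero    h φ = refl
foldr-applyUpTo (suc m) h φ = cong (_+_ (h (φ 0))) (foldr-applyUpTo m h (φ ∘ suc))

coeff-⊛ : ∀ f g n → (f ⊛ g) n ≡ ∑[ i < suc n ] (f (toℕ i) * g (n ∸ toℕ i))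
coeff-⊛ f g n = foldr-applyUpTo (suc n) (λ i → f i * g (n ∸ i)) id

shift : PS → PS
shift f zero    = + 0
shift f (suc n) = f n

⊛-congˡ : ∀ {f f′} g → f ≗ f′ → f ⊛ g ≗ f′ ⊛ g
⊛-congˡ {f} {f′} g f≗f′ n = begin
  (f ⊛ g) n                                    ≡⟨ coeff-⊛ f g n ⟩
  ∑[ i < suc n ] (f (toℕ i) * g (n ∸ toℕ i))   ≡⟨ sum-cong-≗ {suc n} (λ i → cong (_* g (n ∸ toℕ i)) (f≗f′ (toℕ i))) ⟩
  ∑[ i < suc n ] (f′ (toℕ i) * g (n ∸ toℕ i))  ≡⟨ coeff-⊛ f′ g n ⟨
  (f′ ⊛ g) n                                   ∎

⊛-comm : ∀ f g → f ⊛ g ≗ g ⊛ f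
⊛-comm f g n = begin
  (f ⊛ g) n                                             ≡⟨ coeff-⊛ f g n ⟩
  ∑[ i < suc n ] (f (toℕ i) * g (n ∸ toℕ i))            ≡⟨ ∑-reverse (suc n) (λ i → f i * g (n ∸ i)) ⟨
  ∑[ i < suc n ] (f (n ∸ toℕ i) * g (n ∸ (n ∸ toℕ i)))  ≡⟨ sum-cong-≗ swap ⟩
  ∑[ i < suc n ] (g (toℕ i) * f (n ∸ toℕ i))            ≡⟨ coeff-⊛ g f n ⟨
  (g ⊛ f) n                                             ∎
  where
  swap : ∀ (i : Fin (suc n)) → f (n ∸ toℕ i) * g (n ∸ (n ∸ toℕ i)) ≡ g (toℕ i) * f (n ∸ toℕ i)
  swap i rewrite m∸[m∸n]≡n (toℕ≤pred[n] i) = *-comm (f (n ∸ toℕ i)) (g (toℕ i))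

⊛-congʳ : ∀ f {g g′} → g ≗ g′ → f ⊛ g ≗ f ⊛ g′
⊛-congʳ f {g} {g′} g≗g′ n = begin
  (f ⊛ g) n   ≡⟨ ⊛-comm f g n ⟩
  (g ⊛ f) n   ≡⟨ ⊛-congˡ f g≗g′ n ⟩
  (g′ ⊛ f) n  ≡⟨ ⊛-comm g′ f n ⟩
  (f ⊛ g′) n  ∎

⊛-distribʳ-⊖ : ∀ f g h → (f ⊖ g) ⊛ h ≗ (f ⊛ h) ⊖ (g ⊛ h)
⊛-distribʳ-⊖ f g h n = begin
  ((f ⊖ g) ⊛ h) n
    ≡⟨ coeff-⊛ (f ⊖ g) h n ⟩
  ∑[ i < suc n ] ((f (toℕ i) - g (toℕ i)) * h (n ∸ toℕ i))
    ≡⟨ sum-cong-≗ {suc n} (λ i → distrib (f (toℕ i)) (g (toℕ i)) (h (n ∸ toℕ i))) ⟩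
  ∑[ i < suc n ] (f (toℕ i) * h (n ∸ toℕ i) - g (toℕ i) * h (n ∸ toℕ i))
    ≡⟨ ∑-distrib-- {suc n} (λ i → f (toℕ i) * h (n ∸ toℕ i)) (λ i → g (toℕ i) * h (n ∸ toℕ i)) ⟩
  ∑[ i < suc n ] (f (toℕ i) * h (n ∸ toℕ i)) - ∑[ i < suc n ] (g (toℕ i) * h (n ∸ toℕ i))
    ≡⟨ cong₂ _-_ (coeff-⊛ f h n) (coeff-⊛ g h n) ⟨
  ((f ⊛ h) ⊖ (g ⊛ h)) n
    ∎
  where
  distrib : ∀ a b c → (a - b) * c ≡ a * c - b * c
  distrib = solve-∀

⊛-distribˡ-⊖ : ∀ f g h → f ⊛ (g ⊖ h) ≗ (f ⊛ g) ⊖ (f ⊛ h)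
⊛-distribˡ-⊖ f g h n = begin
  (f ⊛ (g ⊖ h)) n         ≡⟨ ⊛-comm f (g ⊖ h) n ⟩
  ((g ⊖ h) ⊛ f) n         ≡⟨ ⊛-distribʳ-⊖ g h f n ⟩
  (g ⊛ f) n - (h ⊛ f) n   ≡⟨ cong₂ _-_ (⊛-comm g f n) (⊛-comm h f n) ⟩
  (f ⊛ g) n - (f ⊛ h) n   ∎

⊛-identityˡ : ∀ g → 𝟙 ⊛ g ≗ g
⊛-identityˡ g n = begin
  (𝟙 ⊛ g) n                                           ≡⟨ coeff-⊛ 𝟙 g n ⟩
  + 1 * g n + ∑[ i < n ] (+ 0 * g (n ∸ suc (toℕ i)))  ≡⟨ cong₂ _+_ (*-identityˡ (g n)) (sum-replicate-zero n) ⟩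
  g n + + 0                                           ≡⟨ +-identityʳ (g n) ⟩
  g n                                                 ∎

⊛-identityʳ : ∀ f → f ⊛ 𝟙 ≗ f
⊛-identityʳ f n = trans (⊛-comm f 𝟙 n) (⊛-identityˡ f n)

shift-cong : ∀ {f g} → f ≗ g → shift f ≗ shift g
shift-cong f≗g zero    = refl
shift-cong f≗g (suc n) = f≗g n

shift-⊛ : ∀ f g → shift f ⊛ g ≗ shift (f ⊛ g)
shift-⊛ f g zero    = refl
shift-⊛ f g (suc n) = trans (coeff-⊛ (shift f) g (suc n)) (trans (+-identityˡ _) (sym (coeff-⊛ f g n)))

⊛-shift : ∀ f g → f ⊛ shift g ≗ shift (f ⊛ g)
⊛-shift f g n = trans (⊛-comm f (shift g) n) (trans (shift-⊛ g f n) (shift-cong (⊛-comm g f) n))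

𝕩≗shift-𝟙 : 𝕩 ≗ shift 𝟙
𝕩≗shift-𝟙 zero          = refl
𝕩≗shift-𝟙 (suc zero)    = refl
𝕩≗shift-𝟙 (suc (suc n)) = refl

𝕩-⊛ : ∀ g → 𝕩 ⊛ g ≗ shift g
𝕩-⊛ g n = begin
  (𝕩 ⊛ g) n        ≡⟨ ⊛-congˡ g 𝕩≗shift-𝟙 n ⟩
  (shift 𝟙 ⊛ g) n  ≡⟨ shift-⊛ 𝟙 g n ⟩
  shift (𝟙 ⊛ g) n  ≡⟨ shift-cong (⊛-identityˡ g) n ⟩
  shift g n        ∎

⊛-𝟙-𝕩 : ∀ f → f ⊛ (𝟙 ⊖ 𝕩) ≗ f ⊖ shift f
⊛-𝟙-𝕩 f n = begin
  (f ⊛ (𝟙 ⊖ 𝕩)) n           ≡⟨ ⊛-distribˡ-⊖ f 𝟙 𝕩 n ⟩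
  (f ⊛ 𝟙) n - (f ⊛ 𝕩) n     ≡⟨ cong₂ _-_ (⊛-identityʳ f n) (⊛-comm f 𝕩 n) ⟩
  f n - (𝕩 ⊛ f) n           ≡⟨ cong (_-_ (f n)) (𝕩-⊛ f n) ⟩
  f n - shift f n           ∎

𝟙-x² : PS
𝟙-x² = 𝟙 ⊖ (𝕩 ⊛ 𝕩)

𝟙-x²-⊛ : ∀ g → 𝟙-x² ⊛ g ≗ g ⊖ shift (shift g)
𝟙-x²-⊛ g n = begin
  (𝟙-x² ⊛ g) n                      ≡⟨ ⊛-distribʳ-⊖ 𝟙 (𝕩 ⊛ 𝕩) g n ⟩
  (𝟙 ⊛ g) n - ((𝕩 ⊛ 𝕩) ⊛ g) n       ≡⟨ cong₂ _-_ (⊛-identityˡ g n) (⊛-congˡ g (𝕩-⊛ 𝕩) n) ⟩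
  g n - (shift 𝕩 ⊛ g) n             ≡⟨ cong (_-_ (g n)) (shift-⊛ 𝕩 g n) ⟩
  g n - shift (𝕩 ⊛ g) n             ≡⟨ cong (_-_ (g n)) (shift-cong (𝕩-⊛ g) n) ⟩
  g n - shift (shift g) n           ∎

⊛-𝟙-x²^suc : ∀ f j → f ⊛ (𝟙-x² ^ˢ suc j) ≗ (f ⊛ (𝟙-x² ^ˢ j)) ⊖ shift (shift (f ⊛ (𝟙-x² ^ˢ j)))
⊛-𝟙-x²^suc f j n = begin
  (f ⊛ (𝟙-x² ⊛ g)) n                        ≡⟨ ⊛-congʳ f (𝟙-x²-⊛ g) n ⟩
  (f ⊛ (g ⊖ shift (shift g))) n             ≡⟨ ⊛-distribˡ-⊖ f g (shift (shift g)) n ⟩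
  (f ⊛ g) n - (f ⊛ shift (shift g)) n       ≡⟨ cong (_-_ ((f ⊛ g) n)) (⊛-shift f (shift g) n) ⟩
  (f ⊛ g) n - shift (f ⊛ shift g) n         ≡⟨ cong (_-_ ((f ⊛ g) n)) (shift-cong (⊛-shift f g) n) ⟩
  (f ⊛ g) n - shift (shift (f ⊛ g)) n       ∎
  where
  g : PS
  g = 𝟙-x² ^ˢ j

⊛-𝟙-x²^-low : ∀ f j n → n ℕ.< 2 → (f ⊛ (𝟙-x² ^ˢ j)) n ≡ f n
⊛-𝟙-x²^-low f zero    n       _ = ⊛-identityʳ f n
⊛-𝟙-x²^-low f (suc j) n n<2 = begin
  (f ⊛ (𝟙-x² ^ˢ suc j)) n
    ≡⟨ ⊛-𝟙-x²^suc f j n ⟩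
  (f ⊛ (𝟙-x² ^ˢ j)) n - shift (shift (f ⊛ (𝟙-x² ^ˢ j))) n
    ≡⟨ cong₂ _-_ (⊛-𝟙-x²^-low f j n n<2) (shift²-low n<2) ⟩
  f n - + 0
    ≡⟨ +-identityʳ (f n) ⟩
  f n
    ∎
  where
  shift²-low : ∀ {g n} → n ℕ.< 2 → shift (shift g) n ≡ + 0
  shift²-low {n = 0} _ = refl
  shift²-low {n = 1} _ = refl
  shift²-low {n = suc (suc _)} (ℕ.s≤s (ℕ.s≤s ()))

⊛-𝟙-x²^-+2 : ∀ f j m → (f ⊛ (𝟙-x² ^ˢ j)) (2 ℕ.+ m) ≡ f (2 ℕ.+ m) - ∑[ i < j ] (f ⊛ (𝟙-x² ^ˢ toℕ i)) m
⊛-𝟙-x²^-+2 f zero    m = trans (⊛-identityʳ f (2 ℕ.+ m)) (sym (+-identityʳ _))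
⊛-𝟙-x²^-+2 f (suc j) m = begin
  V (suc j) (2 ℕ.+ m)                                         ≡⟨ ⊛-𝟙-x²^suc f j (2 ℕ.+ m) ⟩
  V j (2 ℕ.+ m) - V j m                                       ≡⟨ cong (_- V j m) (⊛-𝟙-x²^-+2 f j m) ⟩
  f (2 ℕ.+ m) - ∑[ i < j ] V (toℕ i) m - V j m                ≡⟨ sub-sub (f (2 ℕ.+ m)) _ _ ⟩
  f (2 ℕ.+ m) - (∑[ i < j ] V (toℕ i) m + V j m)              ≡⟨ cong (_-_ (f (2 ℕ.+ m))) (∑-toℕ-suc j (λ i → V i m)) ⟨
  f (2 ℕ.+ m) - ∑[ i < suc j ] V (toℕ i) m                    ∎
  where
  V : ℕ → PS
  V i = f ⊛ (𝟙-x² ^ˢ i)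
  sub-sub : ∀ a b c → a - b - c ≡ a - (b + c)
  sub-sub = solve-∀

count : {A : Set} → (A → Bool) → List A → ℕ
count p xs = length (filter (λ x → p x ≟ true) xs)

count-++ : ∀ {A : Set} (p : A → Bool) xs ys → count p (xs ++ ys) ≡ count p xs ℕ.+ count p ys
count-++ p xs ys = trans (cong length (filter-++ (λ x → p x ≟ true) xs ys)) (length-++ (filter (λ x → p x ≟ true) xs))

count-map : ∀ {A B : Set} (p : B → Bool) (g : A → B) xs → count p (map g xs) ≡ count (p ∘ g) xs
count-map p g []       = refl
count-map p g (x ∷ xs) with p (g x)
... | true  = cong suc (count-map p g xs)
... | false = count-map p g xs

count-cong : ∀ {A : Set} {p q : A → Bool} → p ≗ q → ∀ xs → count p xs ≡ count q xs
count-cong p≗q []       = refl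
count-cong {p = p} {q} p≗q (x ∷ xs) with p x | q x | p≗q x
... | true  | .true  | refl = cong suc (count-cong p≗q xs)
... | false | .false | refl = count-cong p≗q xs

count-false : ∀ {A : Set} (xs : List A) → count (λ _ → false) xs ≡ 0
count-false []       = refl
count-false (x ∷ xs) = count-false xs

count-∧ : ∀ {A : Set} c (p : A → Bool) xs → + count (λ x → c ∧ p x) xs ≡ (if c then + count p xs else + 0)
count-∧ true  p xs = refl
count-∧ false p xs = cong +_ (count-false xs)

count-concatMap : ∀ {A B : Set} {n} (p : A → Bool) (h : B → List A) (f : Fin n → B) →
                  + count p (concatMap h (tabulate f)) ≡ ∑[ i < n ] (+ count p (h (f i)))
count-concatMap {n = zero}  p h f = refl
count-concatMap {n = suc n} p h f = begin
  + count p (h (f zero) ++ concatMap h (tabulate (f ∘ suc)))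
    ≡⟨ cong +_ (count-++ p (h (f zero)) _) ⟩
  + (count p (h (f zero)) ℕ.+ count p (concatMap h (tabulate (f ∘ suc))))
    ≡⟨ pos-+ (count p (h (f zero))) _ ⟩
  + count p (h (f zero)) + + count p (concatMap h (tabulate (f ∘ suc)))
    ≡⟨ cong (_+_ (+ count p (h (f zero)))) (count-concatMap p h (f ∘ suc)) ⟩
  + count p (h (f zero)) + ∑[ i < n ] (+ count p (h (f (suc i))))
    ∎

count-words-suc : ∀ k n (p : List (Fin k) → Bool) →
                  + count p (words k (suc n)) ≡ ∑[ a < k ] (+ count (λ w → p (a ∷ w)) (words k n))
count-words-suc k n p = trans (count-concatMap p (λ a → map (a ∷_) (words k n)) id)
                              (sum-cong-≗ {k} (λ a → cong +_ (count-map p (a ∷_) (words k n))))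

f122-from : (k n : ℕ) → Fin k → ℕ
f122-from k n a = count (λ w → avoids122 (a ∷ w)) (words k n)

f122-suc : ∀ k n → + f122 (suc n) k ≡ ∑[ a < k ] (+ f122-from k n a)
f122-suc k n = count-words-suc k n avoids122

f122-from-1 : ∀ k (a : Fin k) → + f122-from k 1 a ≡ + f122 1 k
f122-from-1 k a = trans (count-words-suc k 0 (λ w → avoids122 (a ∷ w))) (sym (f122-suc k 0))

n<ᵇn≡false : ∀ n → (n <ᵇ n) ≡ false
n<ᵇn≡false zero    = refl
n<ᵇn≡false (suc n) = n<ᵇn≡false n

avoids122-repeat : ∀ {k} (b : Fin k) w → avoids122 (b ∷ b ∷ w) ≡ avoids122 (b ∷ w)
avoids122-repeat b []      = refl
avoids122-repeat b (c ∷ w) rewrite n<ᵇn≡false (toℕ b) = refl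

f122-from-+2 : ∀ k m (a : Fin k) →
               + f122-from k (2 ℕ.+ m) a + ∑[ b < k ] (if toℕ a <ᵇ toℕ b then + f122-from k m b else + 0)
               ≡ + f122 (2 ℕ.+ m) k
f122-from-+2 k m a = begin
  + f122-from k (2 ℕ.+ m) a + ∑[ b < k ] Y b
    ≡⟨ cong (_+ ∑[ b < k ] Y b) expand ⟩
  ∑[ b < k ] X (toℕ a <ᵇ toℕ b) b + ∑[ b < k ] Y b
    ≡⟨ ∑-distrib-+ {k} (λ b → X (toℕ a <ᵇ toℕ b) b) Y ⟨
  ∑[ b < k ] (X (toℕ a <ᵇ toℕ b) b + Y b)
    ≡⟨ sum-cong-≗ {k} (λ b → restore (toℕ a <ᵇ toℕ b) b) ⟩
  ∑[ b < k ] ∑[ c < k ] D b c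
    ≡⟨ sum-cong-≗ {k} (λ b → count-words-suc k m (λ w → avoids122 (b ∷ w))) ⟨
  ∑[ b < k ] (+ f122-from k (suc m) b)
    ≡⟨ f122-suc k (suc m) ⟨
  + f122 (2 ℕ.+ m) k
    ∎
  where
  D : Fin k → Fin k → ℤ
  D b c = + count (λ w → avoids122 (b ∷ c ∷ w)) (words k m)
  X : Bool → Fin k → ℤ
  X a<b b = ∑[ c < k ] (if not (a<b ∧ (toℕ b ≡ᵇ toℕ c)) then D b c else + 0)
  Y : Fin k → ℤ
  Y b = if toℕ a <ᵇ toℕ b then + f122-from k m b else + 0
  expand : + f122-from k (2 ℕ.+ m) a ≡ ∑[ b < k ] X (toℕ a <ᵇ toℕ b) b
  expand = trans (count-words-suc k (suc m) (λ w → avoids122 (a ∷ w)))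
    (sum-cong-≗ {k} (λ b → trans (count-words-suc k m (λ w → avoids122 (a ∷ b ∷ w)))
      (sum-cong-≗ {k} (λ c → count-∧ _ (λ w → avoids122 (b ∷ c ∷ w)) (words k m)))))
  restore : ∀ a<b b → X a<b b + (if a<b then + f122-from k m b else + 0) ≡ ∑[ c < k ] D b c
  restore false b = +-identityʳ _
  restore true  b = trans (cong (_+_ (X true b)) (cong +_ (count-cong (λ w → sym (avoids122-repeat b w)) (words k m))))
                          (∑-pull-out (D b) b)

f122-from≡F122⊛𝟙-x²^ : ∀ k n (a : Fin k) → + f122-from k n a ≡ (F122 k ⊛ (𝟙-x² ^ˢ (k ∸ suc (toℕ a)))) n
f122-from≡F122⊛𝟙-x²^ k 0 a = sym (⊛-𝟙-x²^-low (F122 k) (k ∸ suc (toℕ a)) 0 (ℕ.s≤s ℕ.z≤n))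
f122-from≡F122⊛𝟙-x²^ k 1 a = trans (f122-from-1 k a) (sym (⊛-𝟙-x²^-low (F122 k) (k ∸ suc (toℕ a)) 1 (ℕ.s≤s (ℕ.s≤s ℕ.z≤n))))
f122-from≡F122⊛𝟙-x²^ k (suc (suc m)) a = begin
  + f122-from k (2 ℕ.+ m) a
    ≡⟨ solve-for-x (∑[ b < k ] (if toℕ a <ᵇ toℕ b then + f122-from k m b else + 0)) (f122-from-+2 k m a) ⟩
  F (2 ℕ.+ m) - ∑[ b < k ] (if toℕ a <ᵇ toℕ b then + f122-from k m b else + 0)
    ≡⟨ cong (_-_ (F (2 ℕ.+ m))) (sum-cong-≗ {k} (λ b → cong (λ x → if toℕ a <ᵇ toℕ b then x else + 0) (f122-from≡F122⊛𝟙-x²^ k m b))) ⟩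
  F (2 ℕ.+ m) - ∑[ b < k ] (if toℕ a <ᵇ toℕ b then V (k ∸ suc (toℕ b)) m else + 0)
    ≡⟨ cong (_-_ (F (2 ℕ.+ m))) (∑-above a (λ i → V i m)) ⟩
  F (2 ℕ.+ m) - ∑[ i < k ∸ suc (toℕ a) ] V (toℕ i) m
    ≡⟨ ⊛-𝟙-x²^-+2 F (k ∸ suc (toℕ a)) m ⟨
  V (k ∸ suc (toℕ a)) (2 ℕ.+ m)
    ∎
  where
  F : PS
  F = F122 k
  V : ℕ → PS
  V j = F ⊛ (𝟙-x² ^ˢ j)
  solve-for-x : ∀ {x z} y → x + y ≡ z → x ≡ z - y
  solve-for-x {x} y refl = sym (cancel x y)
    where
    cancel : ∀ a b → a + b - b ≡ a
    cancel = solve-∀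

f122-suc≡∑F122⊛𝟙-x²^ : ∀ k m → + f122 (suc m) k ≡ ∑[ i < k ] (F122 k ⊛ (𝟙-x² ^ˢ toℕ i)) m
f122-suc≡∑F122⊛𝟙-x²^ k m = begin
  + f122 (suc m) k                                      ≡⟨ f122-suc k m ⟩
  ∑[ a < k ] (+ f122-from k m a)                        ≡⟨ sum-cong-≗ {k} (λ a → f122-from≡F122⊛𝟙-x²^ k m a) ⟩
  ∑[ a < k ] (F122 k ⊛ (𝟙-x² ^ˢ (k ∸ suc (toℕ a)))) m   ≡⟨ ∑-reverse k (λ j → (F122 k ⊛ (𝟙-x² ^ˢ j)) m) ⟩
  ∑[ i < k ] (F122 k ⊛ (𝟙-x² ^ˢ toℕ i)) m               ∎

F122-⊛-𝟙-x²^k : ∀ k n → (F122 k ⊛ (𝟙-x² ^ˢ k)) n ≡ F122 k n - shift (F122 k) n + 𝕩 n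
F122-⊛-𝟙-x²^k k 0 = ⊛-𝟙-x²^-low (F122 k) k 0 (ℕ.s≤s ℕ.z≤n)
F122-⊛-𝟙-x²^k k 1 = trans (⊛-𝟙-x²^-low (F122 k) k 1 (ℕ.s≤s (ℕ.s≤s ℕ.z≤n))) (sym (cancel (F122 k 1) (+ 1)))
  where
  cancel : ∀ a b → a - b + b ≡ a
  cancel = solve-∀
F122-⊛-𝟙-x²^k k (suc (suc m)) = begin
  (F122 k ⊛ (𝟙-x² ^ˢ k)) (2 ℕ.+ m)                                   ≡⟨ ⊛-𝟙-x²^-+2 (F122 k) k m ⟩
  F122 k (2 ℕ.+ m) - ∑[ i < k ] (F122 k ⊛ (𝟙-x² ^ˢ toℕ i)) m         ≡⟨ cong (_-_ (F122 k (2 ℕ.+ m))) (f122-suc≡∑F122⊛𝟙-x²^ k m) ⟨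
  F122 k (2 ℕ.+ m) - F122 k (suc m)                                  ≡⟨ +-identityʳ _ ⟨
  F122 k (2 ℕ.+ m) - F122 k (suc m) + + 0                            ∎

theorem3p10 : (k n : ℕ) → (F122 k ⊛ den k) n ≡ 𝕩 n
theorem3p10 k n = begin
  (F ⊛ den k) n                                     ≡⟨ ⊛-distribˡ-⊖ F (𝟙-x² ^ˢ k) (𝟙 ⊖ 𝕩) n ⟩
  (F ⊛ (𝟙-x² ^ˢ k)) n - (F ⊛ (𝟙 ⊖ 𝕩)) n            ≡⟨ cong₂ _-_ (F122-⊛-𝟙-x²^k k n) (⊛-𝟙-𝕩 F n) ⟩
  F n - shift F n + 𝕩 n - (F n - shift F n)         ≡⟨ cancel (F n - shift F n) (𝕩 n) ⟩
  𝕩 n                                               ∎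
  where
  F : PS
  F = F122 k
  cancel : ∀ a b → a + b - a ≡ b
  cancel = solve-∀
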